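{- For all hereditarily finite sets $h_i, h_j \in \mathsf{HF}$, \[ h_i \prec h_j \quad\text{if and only if}\quad h_i \neq h_j \ \text{and}\ \max_\prec(h_i \,\Delta\, h_j) \in h_j, \] where $A \,\Delta\, B = (A\setminus B)\cup(B\setminus A)$ is the symmetric difference and $\max_\prec$ denotes the maximum with respect to the Ackermann ordering $\prec$.
   Context: $\mathsf{HF}=\bigcup_{n\in\mathbb{N}}\mathsf{HF}_n$, where $\mathsf{HF}_0=\emptyset$ and $\mathsf{HF}_{n+1}=\mathscr{P}(\mathsf{HF}_n)$, is the collection of hereditarily finite sets. The Ackermann encoding $\mathbb{N}_A:\mathsf{HF}\to\mathbb{N}$ is defined recursively by $\mathbb{N}_A(h)=\sum_{h'\in h}2^{\mathbb{N}_A(h')}$; it is a bijection. For $i\in\mathbb{N}$, $h_i$ denotes the unique element of $\mathsf{HF}$ with $\mathbb{N}_A(h_i)=i$. The Ackermann ordering $\prec$ on $\mathsf{HF}$ is defined by $h\prec h'$ iff $\mathbb{N}_A(h)<\mathbb{N}_A(h')$. -}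

module Defs where

open import Data.Bool using (Bool; true; false; _∧_; _∨_; if_then_else_; T)
open import Data.List using (List; []; _∷_)
open import Data.Nat using (ℕ; zero; suc; _+_; _^_; _<_; _≤_)
open import Data.Product using (_×_)
open import Data.Sum using (_⊎_)
open import Relation.Nullary using (¬_)

-- Hereditarily finite sets: a set is given by a finite list of its elements
-- (repetitions and order irrelevant; equality is extensional, see _≈_).
data HF : Set where
  mk : List HF → HF

mutual
  eqHF : HF → HF → Bool
  eqHF (mk xs) (mk ys) = subL xs ys ∧ subL ys xs

  subL : List HF → List HF → Bool
  subL [] ys = true
  subL (x ∷ xs) ys = memL x ys ∧ subL xs ys

  memL : HF → List HF → Bool
  memL x [] = false
  memL x (y ∷ ys) = eqHF x y ∨ memL x ys

_≈_ : HF → HF → Set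
h ≈ h' = T (eqHF h h')

_∈_ : HF → HF → Set
x ∈ mk ys = T (memL x ys)

-- Ackermann encoding  N_A(h) = Σ_{h' ∈ h} 2^{N_A(h')}, each element counted once
-- (an element is counted at its last occurrence in the list).
mutual
  NA : HF → ℕ
  NA (mk xs) = NAL xs

  NAL : List HF → ℕ
  NAL [] = 0
  NAL (x ∷ xs) = (if memL x xs then 0 else 2 ^ NA x) + NAL xs

_≺_ : HF → HF → Set
h ≺ h' = NA h < NA h'

_∈Δ[_,_] : HF → HF → HF → Set
x ∈Δ[ A , B ] = (x ∈ A × ¬ (x ∈ B)) ⊎ (x ∈ B × ¬ (x ∈ A))

IsMaxΔ : HF → HF → HF → Set
IsMaxΔ A B m = m ∈Δ[ A , B ] × ((x : HF) → x ∈Δ[ A , B ] → ¬ (m ≺ x))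

module Submission where

-- Reading the Ackermann code of a set h digit by digit, the binary digit
-- of NA h at position k is 1 exactly when k = NA x for some member x of h.  Comparing
-- two binary numerals is decided by the highest position at which their digits differ;
-- since NA is injective on HF up to extensional equality, positions correspond to
-- elements, and that highest position is the code of the ≺-maximum of hi Δ hj.

open import Defs
open import Data.Bool as Bool using (Bool; true; false; _∧_; _∨_; if_then_else_; T)
open import Data.Bool.Properties using (T-≡; T-∧; T-∨; ⇔→≡; ¬-not)
open import Data.List using (List; []; _∷_; map)
open import Data.List.Relation.Unary.All using (All; []; _∷_)
open import Data.List.Relation.Unary.AllPairs using (AllPairs; []; _∷_)
open import Data.Nat using (ℕ; zero; suc; _+_; _^_; _<_; _≤_; _≡ᵇ_; z≤n; s≤s)
open import Data.Nat.ListAction using (sum)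
open import Data.Nat.Properties
open import Data.Product using (Σ; _×_; _,_)
open import Data.Sum as Sum using (_⊎_; inj₁; inj₂)
open import Data.Empty using (⊥-elim)
open import Function.Bundles using (_⇔_; mk⇔; Equivalence)
open import Function.Construct.Composition using (_⇔-∘_)
open import Function.Construct.Symmetry using (⇔-sym)
open import Relation.Nullary using (¬_; yes; no)
open import Relation.Binary.PropositionalEquality

open Equivalence using (to; from)

bits : (ℕ → Bool) → ℕ → ℕ
bits P zero    = 0
bits P (suc N) = bits P N + (if P N then 2 ^ N else 0)

AgreeBetween : (ℕ → Bool) → (ℕ → Bool) → ℕ → ℕ → Set
AgreeBetween P Q lo hi = ∀ j → lo ≤ j → j < hi → P j ≡ Q j

record TopDiff (P Q : ℕ → Bool) (N : ℕ) : Set where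
  constructor topDiff
  field
    pos         : ℕ
    pos<N       : pos < N
    lower       : P pos ≡ false
    upper       : Q pos ≡ true
    agree-above : AgreeBetween P Q (suc pos) N

agree-empty : ∀ {P Q} n → AgreeBetween P Q n n
agree-empty n j n≤j j<n = ⊥-elim (<⇒≱ j<n n≤j)

agree-extend : ∀ {P Q} lo hi → AgreeBetween P Q lo hi → P hi ≡ Q hi →
               AgreeBetween P Q lo (suc hi)
agree-extend lo hi agree top j lo≤j j<1+hi with m<1+n⇒m<n∨m≡n j<1+hi
... | inj₁ j<hi = agree j lo≤j j<hi
... | inj₂ refl = top

bits-cong : ∀ P Q N → AgreeBetween P Q 0 N → bits P N ≡ bits Q N
bits-cong P Q zero    agree = refl
bits-cong P Q (suc N) agree =
  cong₂ (λ m b → m + (if b then 2 ^ N else 0))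
        (bits-cong P Q N (λ j _ j<N → agree j z≤n (m<n⇒m<1+n j<N)))
        (agree N z≤n (n<1+n N))

bits-<2^ : ∀ P N → bits P N < 2 ^ N
bits-<2^ P zero    = s≤s z≤n
bits-<2^ P (suc N) =
  subst (bits P N + (if P N then 2 ^ N else 0) <_) double
        (+-mono-<-≤ (bits-<2^ P N) (digit≤ (P N)))
  where
  digit≤ : ∀ b → (if b then 2 ^ N else 0) ≤ 2 ^ N
  digit≤ true  = ≤-refl
  digit≤ false = z≤n
  double : 2 ^ N + 2 ^ N ≡ 2 ^ suc N
  double = cong (2 ^ N +_) (sym (+-identityʳ (2 ^ N)))

topDiff⇒bits-< : ∀ P Q N → TopDiff P Q N → bits P N < bits Q N
topDiff⇒bits-< P Q (suc N) (topDiff k k<1+N Pk Qk agree) with m<1+n⇒m<n∨m≡n k<1+N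
... | inj₁ k<N rewrite agree N k<N (n<1+n N) =
  +-monoˡ-< _ (topDiff⇒bits-< P Q N
    (topDiff k k<N Pk Qk (λ j k<j j<N → agree j k<j (m<n⇒m<1+n j<N))))
... | inj₂ refl rewrite Pk | Qk = begin-strict
  bits P k + 0   ≡⟨ +-identityʳ (bits P k) ⟩
  bits P k       <⟨ bits-<2^ P k ⟩
  2 ^ k          ≤⟨ m≤n+m (2 ^ k) (bits Q k) ⟩
  bits Q k + 2 ^ k ∎
  where open ≤-Reasoning

Comparison : (ℕ → Bool) → (ℕ → Bool) → ℕ → Set
Comparison P Q N = AgreeBetween P Q 0 N ⊎ TopDiff P Q N ⊎ TopDiff Q P N

comparison-extend : ∀ P Q N → P N ≡ Q N → Comparison P Q N → Comparison P Q (suc N)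
comparison-extend P Q N PN≡QN =
  Sum.map (λ agree → agree-extend 0 N agree PN≡QN)
          (Sum.map (topDiff-extend PN≡QN) (topDiff-extend (sym PN≡QN)))
  where
  topDiff-extend : ∀ {R S} → R N ≡ S N → TopDiff R S N → TopDiff R S (suc N)
  topDiff-extend RN≡SN (topDiff k k<N lower upper agree) =
    topDiff k (m<n⇒m<1+n k<N) lower upper (agree-extend (suc k) N agree RN≡SN)

comparison : ∀ P Q N → Comparison P Q N
comparison P Q zero = inj₁ (agree-empty 0)
comparison P Q (suc N) with P N in PN | Q N in QN
... | false | true  = inj₂ (inj₁ (topDiff N (n<1+n N) PN QN (agree-empty (suc N))))
... | true  | false = inj₂ (inj₂ (topDiff N (n<1+n N) QN PN (agree-empty (suc N))))
... | true  | true  = comparison-extend P Q N (trans PN (sym QN)) (comparison P Q N)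
... | false | false = comparison-extend P Q N (trans PN (sym QN)) (comparison P Q N)

bits-<⇔topDiff : ∀ P Q N → bits P N < bits Q N ⇔ TopDiff P Q N
bits-<⇔topDiff P Q N = mk⇔ bits-<⇒topDiff (topDiff⇒bits-< P Q N)
  where
  bits-<⇒topDiff : bits P N < bits Q N → TopDiff P Q N
  bits-<⇒topDiff P<Q with comparison P Q N
  ... | inj₁ agree       = ⊥-elim (<-irrefl (bits-cong P Q N agree) P<Q)
  ... | inj₂ (inj₁ diff) = diff
  ... | inj₂ (inj₂ diff) = ⊥-elim (<-asym P<Q (topDiff⇒bits-< Q P N diff))

bits-injective : ∀ P Q N → bits P N ≡ bits Q N → AgreeBetween P Q 0 N
bits-injective P Q N P≡Q with comparison P Q N
... | inj₁ agree       = agree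
... | inj₂ (inj₁ diff) = ⊥-elim (<-irrefl P≡Q (topDiff⇒bits-< P Q N diff))
... | inj₂ (inj₂ diff) = ⊥-elim (<-irrefl (sym P≡Q) (topDiff⇒bits-< Q P N diff))

T-ext : ∀ {x y} → (T x ⇔ T y) → x ≡ y
T-ext x⇔y = ⇔→≡ (T-≡ ⇔-∘ (x⇔y ⇔-∘ ⇔-sym T-≡))

-- Finite sets of naturals presented by lists, with the same membership, inclusion and
-- Ackermann value as HF sets have in Defs (each element counted once).  The lists of
-- codes of the elements of an HF set are such lists.
memℕ : ℕ → List ℕ → Bool
memℕ k []       = false
memℕ k (j ∷ js) = (k ≡ᵇ j) ∨ memℕ k js

subℕ : List ℕ → List ℕ → Bool
subℕ []       B = true
subℕ (k ∷ ks) B = memℕ k B ∧ subℕ ks B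

ackℕ : List ℕ → ℕ
ackℕ []       = 0
ackℕ (k ∷ ks) = (if memℕ k ks then 0 else 2 ^ k) + ackℕ ks

digits : List ℕ → ℕ → Bool
digits A j = memℕ j A

Bounded : ℕ → (ℕ → Bool) → Set
Bounded N P = ∀ j → P j ≡ true → j < N

memℕ-here : ∀ k ks → T (memℕ k (k ∷ ks))
memℕ-here k ks = from T-∨ (inj₁ (≡⇒≡ᵇ k k refl))

memℕ-there : ∀ j k ks → T (memℕ j ks) → T (memℕ j (k ∷ ks))
memℕ-there j k ks j∈ks = from T-∨ (inj₂ j∈ks)

memℕ-≤-sum : ∀ j A → T (memℕ j A) → j ≤ sum A
memℕ-≤-sum j (k ∷ ks) j∈A with to T-∨ j∈A
... | inj₁ j≡ᵇk = ≤-trans (≤-reflexive (≡ᵇ⇒≡ j k j≡ᵇk)) (m≤m+n k (sum ks))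
... | inj₂ j∈ks = ≤-trans (memℕ-≤-sum j ks j∈ks) (m≤n+m (sum ks) k)

bounded-by-sum : ∀ A M → sum A ≤ M → Bounded (suc M) (digits A)
bounded-by-sum A M sumA≤M j j∈A = s≤s (≤-trans (memℕ-≤-sum j A (from T-≡ j∈A)) sumA≤M)

subℕ⇔⊆ : ∀ A B → T (subℕ A B) ⇔ (∀ j → T (memℕ j A) → T (memℕ j B))
subℕ⇔⊆ A B = mk⇔ (⊆ A) (sub A)
  where
  ⊆ : ∀ A → T (subℕ A B) → ∀ j → T (memℕ j A) → T (memℕ j B)
  ⊆ (k ∷ ks) A⊆B j j∈A with to T-∧ A⊆B | to T-∨ j∈A
  ... | k∈B , _    | inj₁ j≡ᵇk = subst (λ i → T (memℕ i B)) (sym (≡ᵇ⇒≡ j k j≡ᵇk)) k∈B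
  ... | _ , ks⊆B | inj₂ j∈ks = ⊆ ks ks⊆B j j∈ks
  sub : ∀ A → (∀ j → T (memℕ j A) → T (memℕ j B)) → T (subℕ A B)
  sub []       _   = _
  sub (k ∷ ks) A⊆B = from T-∧ (A⊆B k (memℕ-here k ks) ,
                               sub ks (λ j j∈ks → A⊆B j (memℕ-there j k ks j∈ks)))

≡ᵇ-refl : ∀ n → (n ≡ᵇ n) ≡ true
≡ᵇ-refl n = to T-≡ (≡⇒≡ᵇ n n refl)

≢⇒≡ᵇ-false : ∀ m n → m ≢ n → (m ≡ᵇ n) ≡ false
≢⇒≡ᵇ-false m n m≢n = ¬-not (λ m≡ᵇn → m≢n (≡ᵇ⇒≡ m n (from T-≡ m≡ᵇn)))

insert-agree-below : ∀ P k → AgreeBetween (λ j → (j ≡ᵇ k) ∨ P j) P 0 k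
insert-agree-below P k j _ j<k rewrite ≢⇒≡ᵇ-false j k (λ j≡k → <-irrefl j≡k j<k) = refl

bits-insert : ∀ P k N → k < N →
              bits (λ j → (j ≡ᵇ k) ∨ P j) N ≡ (if P k then 0 else 2 ^ k) + bits P N
bits-insert P k (suc N) k<1+N with m<1+n⇒m<n∨m≡n k<1+N
... | inj₁ k<N rewrite bits-insert P k N k<N | ≢⇒≡ᵇ-false N k (λ N≡k → <-irrefl (sym N≡k) k<N) =
  +-assoc (if P k then 0 else 2 ^ k) (bits P N) _
... | inj₂ refl rewrite ≡ᵇ-refl k | bits-cong _ P k (insert-agree-below P k) with P k
... | true  = refl
... | false = trans (+-comm (bits P k) (2 ^ k)) (cong (2 ^ k +_) (sym (+-identityʳ (bits P k))))

bits-empty : ∀ N → bits (λ _ → false) N ≡ 0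
bits-empty zero    = refl
bits-empty (suc N) = cong (_+ 0) (bits-empty N)

ackℕ-bits : ∀ A N → Bounded N (digits A) → ackℕ A ≡ bits (digits A) N
ackℕ-bits []       N _     = sym (bits-empty N)
ackℕ-bits (k ∷ ks) N bound = begin
  (if memℕ k ks then 0 else 2 ^ k) + ackℕ ks
    ≡⟨ cong (_ +_) (ackℕ-bits ks N (λ j j∈ks → bound j (to T-≡ (memℕ-there j k ks (from T-≡ j∈ks))))) ⟩
  (if memℕ k ks then 0 else 2 ^ k) + bits (digits ks) N
    ≡⟨ bits-insert (digits ks) k N (bound k (to T-≡ (memℕ-here k ks))) ⟨
  bits (digits (k ∷ ks)) N ∎
  where open ≡-Reasoning

ackℕ-≡⇔same : ∀ A B → ackℕ A ≡ ackℕ B ⇔ (∀ j → memℕ j A ≡ memℕ j B)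
ackℕ-≡⇔same A B = mk⇔ same equal
  where
  open ≡-Reasoning
  -- every numeral width above both sums represents both lists
  width : ℕ → ℕ
  width n = suc (sum A + sum B + n)
  boundA : ∀ n → Bounded (width n) (digits A)
  boundA n = bounded-by-sum A _ (≤-trans (m≤m+n (sum A) (sum B)) (m≤m+n _ n))
  boundB : ∀ n → Bounded (width n) (digits B)
  boundB n = bounded-by-sum B _ (≤-trans (m≤n+m (sum B) (sum A)) (m≤m+n _ n))
  same : ackℕ A ≡ ackℕ B → ∀ j → memℕ j A ≡ memℕ j B
  same A≡B j = bits-injective (digits A) (digits B) (width j)
    (trans (sym (ackℕ-bits A _ (boundA j))) (trans A≡B (ackℕ-bits B _ (boundB j))))
    j z≤n (s≤s (m≤n+m j _))
  equal : (∀ j → memℕ j A ≡ memℕ j B) → ackℕ A ≡ ackℕ B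
  equal A≈B = begin
    ackℕ A                     ≡⟨ ackℕ-bits A _ (boundA 0) ⟩
    bits (digits A) (width 0)  ≡⟨ bits-cong _ _ (width 0) (λ j _ _ → A≈B j) ⟩
    bits (digits B) (width 0)  ≡⟨ ackℕ-bits B _ (boundB 0) ⟨
    ackℕ B                     ∎

mutual-inclusion≡ackℕ-≡ᵇ : ∀ A B → (subℕ A B ∧ subℕ B A) ≡ (ackℕ A ≡ᵇ ackℕ B)
mutual-inclusion≡ackℕ-≡ᵇ A B = T-ext (mk⇔ included⇒equal equal⇒included)
  where
  included⇒equal : T (subℕ A B ∧ subℕ B A) → T (ackℕ A ≡ᵇ ackℕ B)
  included⇒equal A⊆⊇B with to T-∧ A⊆⊇B
  ... | A⊆B , B⊆A = ≡⇒≡ᵇ _ _ (from (ackℕ-≡⇔same A B) λ j →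
    T-ext (mk⇔ (to (subℕ⇔⊆ A B) A⊆B j) (to (subℕ⇔⊆ B A) B⊆A j)))
  equal⇒included : T (ackℕ A ≡ᵇ ackℕ B) → T (subℕ A B ∧ subℕ B A)
  equal⇒included A≡B = from T-∧ (from (subℕ⇔⊆ A B) (λ j → subst T (same j)) ,
                                  from (subℕ⇔⊆ B A) (λ j → subst T (sym (same j))))
    where
    same : ∀ j → memℕ j A ≡ memℕ j B
    same = to (ackℕ-≡⇔same A B) (≡ᵇ⇒≡ _ _ A≡B)

-- The Ackermann codes decide extensional equality of a and b.  Once this holds for all
-- pairs of elements of two sets, membership, inclusion and NAL on their element lists
-- coincide with memℕ, subℕ and ackℕ on the lists of codes, so it holds for the sets.
Coded : HF → HF → Set
Coded a b = eqHF a b ≡ (NA a ≡ᵇ NA b)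

memL-codes : ∀ x ys → All (Coded x) ys → memL x ys ≡ memℕ (NA x) (map NA ys)
memL-codes x []       []       = refl
memL-codes x (y ∷ ys) (c ∷ cs) = cong₂ _∨_ c (memL-codes x ys cs)

subL-codes : ∀ xs ys → All (λ x → All (Coded x) ys) xs → subL xs ys ≡ subℕ (map NA xs) (map NA ys)
subL-codes []       ys []       = refl
subL-codes (x ∷ xs) ys (c ∷ cs) = cong₂ _∧_ (memL-codes x ys c) (subL-codes xs ys cs)

NAL-codes : ∀ xs → AllPairs Coded xs → NAL xs ≡ ackℕ (map NA xs)
NAL-codes []       []       = refl
NAL-codes (x ∷ xs) (c ∷ cs) =
  cong₂ (λ b n → (if b then 0 else 2 ^ NA x) + n) (memL-codes x xs c) (NAL-codes xs cs)

mutual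
  coded : ∀ a b → Coded a b
  coded (mk xs) (mk ys) = begin
    subL xs ys ∧ subL ys xs
      ≡⟨ cong₂ _∧_ (subL-codes xs ys (coded-all² xs ys)) (subL-codes ys xs (coded-all² ys xs)) ⟩
    subℕ (map NA xs) (map NA ys) ∧ subℕ (map NA ys) (map NA xs)
      ≡⟨ mutual-inclusion≡ackℕ-≡ᵇ (map NA xs) (map NA ys) ⟩
    ackℕ (map NA xs) ≡ᵇ ackℕ (map NA ys)
      ≡⟨ cong₂ _≡ᵇ_ (NAL-codes xs (coded-pairs xs)) (NAL-codes ys (coded-pairs ys)) ⟨
    NAL xs ≡ᵇ NAL ys ∎
    where open ≡-Reasoning

  coded-all : ∀ x ys → All (Coded x) ys
  coded-all x []       = []
  coded-all x (y ∷ ys) = coded x y ∷ coded-all x ys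

  coded-all² : ∀ xs ys → All (λ x → All (Coded x) ys) xs
  coded-all² []       ys = []
  coded-all² (x ∷ xs) ys = coded-all x ys ∷ coded-all² xs ys

  coded-pairs : ∀ xs → AllPairs Coded xs
  coded-pairs []       = []
  coded-pairs (x ∷ xs) = coded-all x xs ∷ coded-pairs xs

memL-NA : ∀ x ys → memL x ys ≡ memℕ (NA x) (map NA ys)
memL-NA x ys = memL-codes x ys (coded-all x ys)

code : HF → ℕ → Bool
code (mk xs) = digits (map NA xs)

∈⇔code : ∀ x h → x ∈ h ⇔ code h (NA x) ≡ true
∈⇔code x (mk ys) rewrite memL-NA x ys = T-≡

code-false⇒∉ : ∀ x h → code h (NA x) ≡ false → ¬ x ∈ h
code-false⇒∉ x h x∉h x∈h = true≢false (trans (sym (to (∈⇔code x h) x∈h)) x∉h)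
  where
  true≢false : true ≢ false
  true≢false ()

∉⇒code-false : ∀ x h → ¬ x ∈ h → code h (NA x) ≡ false
∉⇒code-false x h x∉h = ¬-not (λ x∈h → x∉h (from (∈⇔code x h) x∈h))

codes-witness : ∀ k ys → T (memℕ k (map NA ys)) → Σ HF λ y → NA y ≡ k
codes-witness k (y ∷ ys) k∈ys with to T-∨ k∈ys
... | inj₁ k≡ᵇy  = y , sym (≡ᵇ⇒≡ k (NA y) k≡ᵇy)
... | inj₂ k∈ys′ = codes-witness k ys k∈ys′

code-witness : ∀ h k → code h k ≡ true → Σ HF λ x → x ∈ h × NA x ≡ k
code-witness (mk ys) k k∈h with codes-witness k ys (from T-≡ k∈h)
... | x , refl = x , from (∈⇔code x (mk ys)) k∈h , refl

size : HF → ℕ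
size (mk xs) = sum (map NA xs)

code-bounded : ∀ h N → size h < N → Bounded N (code h)
code-bounded (mk xs) N size<N j j∈h =
  ≤-trans (bounded-by-sum (map NA xs) (size (mk xs)) ≤-refl j j∈h) size<N

NA-bits : ∀ h N → Bounded N (code h) → NA h ≡ bits (code h) N
NA-bits (mk xs) N bound = trans (NAL-codes xs (coded-pairs xs)) (ackℕ-bits (map NA xs) N bound)

Δ⇒disagree : ∀ x A B → x ∈Δ[ A , B ] → code A (NA x) ≢ code B (NA x)
Δ⇒disagree x A B (inj₁ (x∈A , x∉B)) A≡B = code-false⇒∉ x A (trans A≡B (∉⇒code-false x B x∉B)) x∈A
Δ⇒disagree x A B (inj₂ (x∈B , x∉A)) A≡B = code-false⇒∉ x B (trans (sym A≡B) (∉⇒code-false x A x∉A)) x∈B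

disagree⇒Δ : ∀ A B j → code A j ≢ code B j → Σ HF λ x → x ∈Δ[ A , B ] × NA x ≡ j
disagree⇒Δ A B j A≢B with code A j in A[j] | code B j in B[j]
... | true  | true  = ⊥-elim (A≢B refl)
... | false | false = ⊥-elim (A≢B refl)
... | true  | false with code-witness A j A[j]
...   | x , x∈A , refl = x , inj₁ (x∈A , code-false⇒∉ x B B[j]) , refl
disagree⇒Δ A B j A≢B | false | true with code-witness B j B[j]
...   | x , x∈B , refl = x , inj₂ (x∈B , code-false⇒∉ x A A[j]) , refl

maxΔ⇔topDiff : ∀ A B N → Bounded N (code A) → Bounded N (code B) →
               Σ HF (λ m → IsMaxΔ A B m × m ∈ B) ⇔ TopDiff (code A) (code B) N
maxΔ⇔topDiff A B N boundA boundB = mk⇔ maxΔ⇒topDiff topDiff⇒maxΔ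
  where
  Δ-bounded : ∀ x → x ∈Δ[ A , B ] → NA x < N
  Δ-bounded x (inj₁ (x∈A , _)) = boundA (NA x) (to (∈⇔code x A) x∈A)
  Δ-bounded x (inj₂ (x∈B , _)) = boundB (NA x) (to (∈⇔code x B) x∈B)

  maxΔ⇒topDiff : Σ HF (λ m → IsMaxΔ A B m × m ∈ B) → TopDiff (code A) (code B) N
  maxΔ⇒topDiff (m , (m∈Δ , maximal) , m∈B) =
    topDiff (NA m) (Δ-bounded m m∈Δ) (∉⇒code-false m A (m∉A m∈Δ)) (to (∈⇔code m B) m∈B) agree
    where
    m∉A : m ∈Δ[ A , B ] → ¬ m ∈ A
    m∉A (inj₁ (_ , m∉B)) = ⊥-elim (m∉B m∈B)
    m∉A (inj₂ (_ , m∉A′)) = m∉A′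
    -- a disagreement above NA m would be an element of A Δ B above m
    agree : AgreeBetween (code A) (code B) (suc (NA m)) N
    agree j m<j _ with code A j Bool.≟ code B j
    ... | yes A≡B = A≡B
    ... | no A≢B with disagree⇒Δ A B j A≢B
    ...   | x , x∈Δ , refl = ⊥-elim (maximal x x∈Δ m<j)

  topDiff⇒maxΔ : TopDiff (code A) (code B) N → Σ HF (λ m → IsMaxΔ A B m × m ∈ B)
  topDiff⇒maxΔ (topDiff k _ lower upper agree) with code-witness B k upper
  ... | m , m∈B , refl = m , (inj₂ (m∈B , code-false⇒∉ m A lower) , maximal) , m∈B
    where
    maximal : ∀ x → x ∈Δ[ A , B ] → ¬ (m ≺ x)
    maximal x x∈Δ m≺x = Δ⇒disagree x A B x∈Δ (agree (NA x) m≺x (Δ-bounded x x∈Δ))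

≈⇒NA-≡ : ∀ a b → a ≈ b → NA a ≡ NA b
≈⇒NA-≡ a b a≈b = ≡ᵇ⇒≡ (NA a) (NA b) (subst T (coded a b) a≈b)

proposition1 : (hi hj : HF) →
    (hi ≺ hj) ⇔ (¬ (hi ≈ hj) × Σ HF (λ m → IsMaxΔ hi hj m × m ∈ hj))
proposition1 hi hj = mk⇔
  (λ hi≺hj → (λ hi≈hj → <-irrefl (≈⇒NA-≡ hi hj hi≈hj) hi≺hj) , from maxΔ (to digits-< hi≺hj))
  (λ (_ , max) → from digits-< (to maxΔ max))
  where
  N : ℕ
  N = suc (size hi + size hj)
  bound-hi : Bounded N (code hi)
  bound-hi = code-bounded hi N (s≤s (m≤m+n (size hi) (size hj)))
  bound-hj : Bounded N (code hj)
  bound-hj = code-bounded hj N (s≤s (m≤n+m (size hj) (size hi)))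
  digits-< : hi ≺ hj ⇔ TopDiff (code hi) (code hj) N
  digits-< rewrite NA-bits hi N bound-hi | NA-bits hj N bound-hj = bits-<⇔topDiff (code hi) (code hj) N
  maxΔ : Σ HF (λ m → IsMaxΔ hi hj m × m ∈ hj) ⇔ TopDiff (code hi) (code hj) N
  maxΔ = maxΔ⇔topDiff hi hj N bound-hi bound-hj
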